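{- Consider $\mathrm{Sublime}_{\mathrm{MG}}$ with an increasing size function $W(\cdot)$ on an insertion-only stream, with time divided into epochs as in the context, and let $k\ge1$ be an integer with $W(N_0)\ge k$. Let $E(N)=\max_x(f(x)-\hat f(x))$ denote its estimation error when the stream has $N$ keys. Then at the end of epoch $i$, $$E(N_i)\le\sum_{j=0}^{i}\frac{N^{\mathrm{res}(k)}_j-N^{\mathrm{res}(k)}_{j-1}}{W(N_j)+1-k},$$ where $N^{\mathrm{res}(k)}_j$ ($j\ge0$) is the total count, among the first $N_j$ stream items, of the keys not among the top $k$ keys of the whole stream, and $N^{\mathrm{res}(k)}_{ -1}=0$.
   Context: Misra-Gries with $w$ slots: each slot stores a key and a counter; on insertion of $x$: if $x$ is stored, increment its counter; else if an empty slot exists, store $(x,1)$; else decrement all counters by one and discard keys whose counters become $0$ ($x$ not stored). $\hat f(x)$ is $x$'s counter if stored, else $0$; $f(x)$ is the true count and $N=\sum_x f(x)$. $\mathrm{Sublime}_{\mathrm{MG}}$ increases its number of slots according to the size function $W$. Epochs: for a sequence $N_0<N_1<\cdots$ with $W(N_0)<W(N_1)<\cdots$, the sketch uses $W(N_0)$ slots until the stream length reaches $N_0$ (epoch 0), and during epoch $j\ge1$ (stream length from $N_{j-1}$ to $N_j$) it uses $W(N_j)$ slots. The top $k$ keys are $k$ keys with largest frequency in the whole stream. -}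

module Defs where

open import Data.Nat as ℕ using (ℕ; zero; suc; _∸_; _≤_; _<_; _≤ᵇ_; _≡ᵇ_)
open import Data.Bool using (Bool; true; false; if_then_else_; not)
open import Data.Product using (_×_; _,_; proj₁)
open import Data.List using (List; []; _∷_; length; take; filter; map; _++_)
open import Data.List.Membership.Propositional using (_∈_; _∉_)
open import Data.List.Relation.Unary.Unique.Propositional using (Unique)
open import Data.Integer as ℤ using (ℤ; +_)
open import Data.Rational as ℚ using (ℚ; _/_)
open import Relation.Nullary.Decidable using (¬?)
open import Data.List.Membership.DecPropositional ℕ._≟_ using (_∈?_)

Key : Set
Key = ℕ

-- A Misra-Gries sketch: list of (key , counter) slots that are in use.
Sketch : Set
Sketch = List (Key × ℕ)

stored : Key → Sketch → Bool
stored x [] = false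
stored x ((y , c) ∷ s) = if x ≡ᵇ y then true else stored x s

incr : Key → Sketch → Sketch
incr x [] = []
incr x ((y , c) ∷ s) = if x ≡ᵇ y then (y , suc c) ∷ s else (y , c) ∷ incr x s

decrAll : Sketch → Sketch
decrAll [] = []
decrAll ((y , zero) ∷ s) = decrAll s
decrAll ((y , suc zero) ∷ s) = decrAll s
decrAll ((y , suc (suc c)) ∷ s) = (y , suc c) ∷ decrAll s

mgInsert : ℕ → Key → Sketch → Sketch
mgInsert w x s =
  if stored x s then incr x s
  else if suc (length s) ≤ᵇ w then s ++ ((x , 1) ∷ [])
  else decrAll s

estimate : Sketch → Key → ℕ
estimate [] x = 0
estimate ((y , c) ∷ s) x = if x ≡ᵇ y then c else estimate s x

count : Key → List Key → ℕ
count x [] = 0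
count x (y ∷ ys) = if x ≡ᵇ y then suc (count x ys) else count x ys

epochSearch : (ℕ → ℕ) → ℕ → ℕ → ℕ → ℕ
epochSearch Ns t j zero = j
epochSearch Ns t j (suc fuel) = if t ≤ᵇ Ns j then j else epochSearch Ns t (suc j) fuel

-- epoch in which the t-th item (1-indexed; stream length t after inserting it)
-- is inserted: the least j with t ≤ N_j  (N strictly increasing, so j ≤ t).
epochOf : (ℕ → ℕ) → ℕ → ℕ
epochOf Ns t = epochSearch Ns t 0 t

slotsAt : (W : ℕ → ℕ) → (Ns : ℕ → ℕ) → ℕ → ℕ
slotsAt W Ns t = W (Ns (epochOf Ns t))

-- Sublime_MG run: process a list of items, the next item being the t-th
runFrom : (W : ℕ → ℕ) → (Ns : ℕ → ℕ) → ℕ → Sketch → List Key → Sketch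
runFrom W Ns t s [] = s
runFrom W Ns t s (x ∷ xs) = runFrom W Ns (suc t) (mgInsert (slotsAt W Ns t) x s) xs

sublimeMG : (W : ℕ → ℕ) → (Ns : ℕ → ℕ) → List Key → ℕ → Sketch
sublimeMG W Ns str n = runFrom W Ns 1 [] (take n str)

IsTopK : ℕ → List Key → List Key → Set
IsTopK k str T =
  Unique T × length T ≡ k ×
  (∀ x y → x ∈ T → y ∉ T → count y str ≤ count x str)
  where open import Relation.Binary.PropositionalEquality using (_≡_)


residual : List Key → List Key → ℕ → ℕ
residual T str n = length (filter (λ x → ¬? (x ∈? T)) (take n str))

-- N^{res}_j with the convention N^{res}_{-1} = 0 (index j here stands for j-1)
residualPrev : List Key → List Key → (ℕ → ℕ) → ℕ → ℕ
residualPrev T str Ns zero = 0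
residualPrev T str Ns (suc j) = residual T str (Ns j)

-- term j of the bound: (N^res_j - N^res_{j-1}) / (W(N_j) + 1 - k)
-- (denominator written suc (W(N_j) ∸ k), equal to W(N_j)+1-k as W(N_j) ≥ k)
boundTerm : (W : ℕ → ℕ) → (Ns : ℕ → ℕ) → ℕ → List Key → List Key → ℕ → ℚ
boundTerm W Ns k T str j =
  (+ residual T str (Ns j) ℤ.- + residualPrev T str Ns j) / suc (W (Ns j) ∸ k)

sumTo : (ℕ → ℚ) → ℕ → ℚ
sumTo f zero = f 0
sumTo f (suc i) = sumTo f i ℚ.+ f (suc i)

toℚ : ℤ → ℚ
toℚ z = z / 1

{-# OPTIONS --safe #-}
-- Fix any k keys T, and call the total counter value of the stored keys outside T the
-- outside mass.  An insertion that decrements all w counters involves w + 1 distinct keys (the stored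
-- ones and the arriving x), at most k of them in T, so the outside mass together with the arrival of x
-- loses at least w − k + 1; otherwise the outside mass grows only by arrivals of keys outside T.  Hence
-- epoch j, with d_j decrements, outside mass m_j at its end and r_j = N^res_j − N^res_{j−1}, satisfies
-- d_j (W(N_j) − k + 1) + m_j ≤ r_j + m_{j−1}.  An estimate falls behind the true count only at a
-- decrement, so E(N_i) ≤ Σ_{j≤i} d_j; and since W(N_j) increases with j, the potential
-- Σ_{j≤i} d_j + m_i / (W(N_i) − k + 1) grows during epoch j by at most r_j / (W(N_j) − k + 1).
module Submission where

open import Defs
open import Data.Nat
  using (ℕ; zero; suc; _+_; _*_; _∸_; _⊓_; _≤_; _<_; _≤′_; ≤′-refl; ≤′-step; z≤n; s≤s; s≤s⁻¹; _≤ᵇ_; _≡ᵇ_)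
open import Data.Nat.Properties
open import Algebra.Properties.CommutativeSemigroup +-commutativeSemigroup using (x∙yz≈y∙xz; xy∙z≈y∙xz; xy∙z≈x∙zy)
open import Data.Bool using (true; false; if_then_else_)
open import Data.Fin using (zero; suc)
open import Data.Fin.Properties using (injective⇒≤)
open import Data.Integer as ℤ using (+_; _-_; +≤+)
import Data.Integer.Properties as ℤ
open import Data.Integer.Tactic.RingSolver using (solve-∀)
open import Data.List using (List; []; _∷_; length; take; drop; filter; map; lookup; _++_)
open import Data.List.Membership.DecPropositional _≟_ using (_∈?_)
open import Data.List.Membership.Propositional using (_∉_)
open import Data.List.Membership.Propositional.Properties using (∈-lookup; ∈-filter⁻)
open import Data.List.Membership.Setoid.Properties using (index-injective)
open import Data.List.Properties
  using (length-++; length-map; length-take; length-drop; map-++; filter-++; take++drop≡id; take-take)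
open import Data.List.Relation.Binary.Subset.Propositional using (_⊆_)
open import Data.List.Relation.Unary.All as All using (All; []; _∷_)
import Data.List.Relation.Unary.All.Properties as All
open import Data.List.Relation.Unary.Any using (here; there; index)
open import Data.List.Relation.Unary.Unique.Propositional using (Unique; []; _∷_)
import Data.List.Relation.Unary.Unique.Propositional.Properties as Unique
open import Data.Product using (_×_; _,_; proj₁; proj₂)
open import Data.Rational using (ℚ; _/_; 0ℚ; toℚᵘ)
import Data.Rational as ℚ
open import Data.Rational.Properties
  using (toℚᵘ-fromℚᵘ; toℚᵘ-cancel-≤; fromℚᵘ-cong; toℚᵘ-injective; toℚᵘ-homo-+; 0/n≡0)
import Data.Rational.Properties as ℚ
open import Data.Rational.Unnormalised as ℚᵘ using (mkℚᵘ; *≡*; *≤*)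
import Data.Rational.Unnormalised.Properties as ℚᵘ
open import Function using (_∘_)
open import Relation.Binary.PropositionalEquality
open import Relation.Nullary using (yes; no; does; contradiction)
open import Relation.Nullary.Decidable using (¬?)
open import Relation.Nullary.Reflects using (Reflects; ofʸ; ofⁿ; fromEquivalence)

-- Counting keys outside a set

count-++ : ∀ y xs ys → count y (xs ++ ys) ≡ count y xs + count y ys
count-++ y []       ys = refl
count-++ y (x ∷ xs) ys with y ≡ᵇ x
... | true  = cong suc (count-++ y xs ys)
... | false = count-++ y xs ys

countNotIn : List Key → List Key → ℕ
countNotIn T xs = length (filter (λ x → ¬? (x ∈? T)) xs)

countNotIn-++ : ∀ T xs ys → countNotIn T (xs ++ ys) ≡ countNotIn T xs + countNotIn T ys
countNotIn-++ T xs ys = trans (cong length (filter-++ _ xs ys)) (length-++ (filter _ xs))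

lookup-injective : ∀ {xs : List Key} → Unique xs → ∀ {i j} → lookup xs i ≡ lookup xs j → i ≡ j
lookup-injective {x ∷ xs} (x∉xs ∷ u) {zero}  {zero}  eq = refl
lookup-injective {x ∷ xs} (x∉xs ∷ u) {zero}  {suc j} eq = contradiction eq (All.lookup x∉xs (∈-lookup j))
lookup-injective {x ∷ xs} (x∉xs ∷ u) {suc i} {zero}  eq = contradiction (sym eq) (All.lookup x∉xs (∈-lookup i))
lookup-injective {x ∷ xs} (x∉xs ∷ u) {suc i} {suc j} eq = cong suc (lookup-injective u eq)

unique-⊆⇒length≤ : ∀ {xs ys : List Key} → Unique xs → xs ⊆ ys → length xs ≤ length ys
unique-⊆⇒length≤ u xs⊆ys = injective⇒≤ {f = λ i → index (xs⊆ys (∈-lookup i))} λ {i} {j} eq →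
  lookup-injective u (index-injective (setoid Key) (xs⊆ys (∈-lookup i)) (xs⊆ys (∈-lookup j)) eq)

length≡length-filter-∈+countNotIn : ∀ T xs → length xs ≡ length (filter (_∈? T) xs) + countNotIn T xs
length≡length-filter-∈+countNotIn T []       = refl
length≡length-filter-∈+countNotIn T (x ∷ xs) with x ∈? T
... | yes _ = cong suc (length≡length-filter-∈+countNotIn T xs)
... | no  _ = trans (cong suc (length≡length-filter-∈+countNotIn T xs)) (sym (+-suc _ _))

length∸length≤countNotIn : ∀ T {xs} → Unique xs → length xs ∸ length T ≤ countNotIn T xs
length∸length≤countNotIn T {xs} u = m≤n+o⇒m∸n≤o (length xs) (length T) (begin
  length xs                                    ≡⟨ length≡length-filter-∈+countNotIn T xs ⟩
  length (filter (_∈? T) xs) + countNotIn T xs ≤⟨ +-monoˡ-≤ (countNotIn T xs) inside≤T ⟩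
  length T + countNotIn T xs                   ∎)
  where
  open ≤-Reasoning
  inside≤T : length (filter (_∈? T) xs) ≤ length T
  inside≤T = unique-⊆⇒length≤ (Unique.filter⁺ (_∈? T) u) (λ x∈ → proj₂ (∈-filter⁻ (_∈? T) {xs = xs} x∈))

-- Misra–Gries sketches

keys : Sketch → List Key
keys = map proj₁

≡ᵇ-reflects : ∀ m n → Reflects (m ≡ n) (m ≡ᵇ n)
≡ᵇ-reflects m n = fromEquivalence (≡ᵇ⇒≡ m n) (≡⇒≡ᵇ m n)

≡ᵇ-refl : ∀ n → (n ≡ᵇ n) ≡ true
≡ᵇ-refl zero    = refl
≡ᵇ-refl (suc n) = ≡ᵇ-refl n

≢⇒≡ᵇ-false : ∀ {m n} → m ≢ n → (m ≡ᵇ n) ≡ false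
≢⇒≡ᵇ-false {m} {n} m≢n with m ≡ᵇ n | ≡ᵇ-reflects m n
... | true  | ofʸ m≡n = contradiction m≡n m≢n
... | false | _       = refl

stored-false⇒∉ : ∀ x s → stored x s ≡ false → x ∉ keys s
stored-false⇒∉ x ((y , c) ∷ s) eq x∈ with x ≡ᵇ y | ≡ᵇ-reflects x y
stored-false⇒∉ x ((y , c) ∷ s) () x∈         | true  | _
stored-false⇒∉ x ((y , c) ∷ s) eq (here x≡y) | false | ofⁿ x≢y = x≢y x≡y
stored-false⇒∉ x ((y , c) ∷ s) eq (there x∈) | false | _       = stored-false⇒∉ x s eq x∈

-- Unfolding incr exposes a second comparison of x with z, hence each rewrite is applied twice.
estimate-incr-self : ∀ x s → stored x s ≡ true → estimate (incr x s) x ≡ suc (estimate s x)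
estimate-incr-self x ((z , c) ∷ s) st with x ≟ z
... | yes refl rewrite ≡ᵇ-refl x | ≡ᵇ-refl x           = refl
... | no x≢z   rewrite ≢⇒≡ᵇ-false x≢z | ≢⇒≡ᵇ-false x≢z = estimate-incr-self x s st

estimate-incr-other : ∀ x s {y} → y ≢ x → estimate (incr x s) y ≡ estimate s y
estimate-incr-other x []                 y≢x = refl
estimate-incr-other x ((z , c) ∷ s) {y} y≢x with x ≟ z
... | yes refl rewrite ≡ᵇ-refl x | ≢⇒≡ᵇ-false y≢x = refl
... | no x≢z   rewrite ≢⇒≡ᵇ-false x≢z with y ≡ᵇ z
...   | true  = refl
...   | false = estimate-incr-other x s y≢x

estimate-not-stored : ∀ x s → stored x s ≡ false → estimate s x ≡ 0
estimate-not-stored x []             st = refl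
estimate-not-stored x ((z , c) ∷ s) st with x ≡ᵇ z
... | false = estimate-not-stored x s st

estimate-append-self : ∀ x s → stored x s ≡ false → estimate (s ++ (x , 1) ∷ []) x ≡ 1
estimate-append-self x []             st rewrite ≡ᵇ-refl x = refl
estimate-append-self x ((z , c) ∷ s) st with x ≡ᵇ z
... | false = estimate-append-self x s st

estimate-append-other : ∀ x s {y} → y ≢ x → estimate (s ++ (x , 1) ∷ []) y ≡ estimate s y
estimate-append-other x []                 y≢x rewrite ≢⇒≡ᵇ-false y≢x = refl
estimate-append-other x ((z , c) ∷ s) {y} y≢x with y ≡ᵇ z
... | true  = refl
... | false = estimate-append-other x s y≢x

estimate≤suc-estimate-decrAll : ∀ s y → estimate s y ≤ suc (estimate (decrAll s) y)
estimate≤suc-estimate-decrAll []                     y = z≤n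
estimate≤suc-estimate-decrAll ((z , zero) ∷ s)        y with y ≡ᵇ z
... | true  = z≤n
... | false = estimate≤suc-estimate-decrAll s y
estimate≤suc-estimate-decrAll ((z , suc zero) ∷ s)    y with y ≡ᵇ z
... | true  = s≤s z≤n
... | false = estimate≤suc-estimate-decrAll s y
estimate≤suc-estimate-decrAll ((z , suc (suc c)) ∷ s) y with y ≡ᵇ z
... | true  = ≤-refl
... | false = estimate≤suc-estimate-decrAll s y

keys-incr : ∀ x s → keys (incr x s) ≡ keys s
keys-incr x []             = refl
keys-incr x ((z , c) ∷ s) with x ≡ᵇ z
... | true  = refl
... | false = cong (z ∷_) (keys-incr x s)

All-keys-decrAll : ∀ {P : Key → Set} s → All P (keys s) → All P (keys (decrAll s))
All-keys-decrAll []                     []        = []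
All-keys-decrAll ((z , zero) ∷ s)        (_ ∷ ps)  = All-keys-decrAll s ps
All-keys-decrAll ((z , suc zero) ∷ s)    (_ ∷ ps)  = All-keys-decrAll s ps
All-keys-decrAll ((z , suc (suc c)) ∷ s) (pz ∷ ps) = pz ∷ All-keys-decrAll s ps

Unique-keys-decrAll : ∀ s → Unique (keys s) → Unique (keys (decrAll s))
Unique-keys-decrAll []                     []        = []
Unique-keys-decrAll ((z , zero) ∷ s)        (_ ∷ u)   = Unique-keys-decrAll s u
Unique-keys-decrAll ((z , suc zero) ∷ s)    (_ ∷ u)   = Unique-keys-decrAll s u
Unique-keys-decrAll ((z , suc (suc c)) ∷ s) (z∉s ∷ u) = All-keys-decrAll s z∉s ∷ Unique-keys-decrAll s u

PositiveCounters : Sketch → Set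
PositiveCounters = All (λ slot → 0 < proj₂ slot)

PositiveCounters-incr : ∀ x s → PositiveCounters s → PositiveCounters (incr x s)
PositiveCounters-incr x []             []       = []
PositiveCounters-incr x ((z , c) ∷ s) (p ∷ ps) with x ≡ᵇ z
... | true  = s≤s z≤n ∷ ps
... | false = p ∷ PositiveCounters-incr x s ps

PositiveCounters-decrAll : ∀ s → PositiveCounters (decrAll s)
PositiveCounters-decrAll []                     = []
PositiveCounters-decrAll ((z , zero) ∷ s)        = PositiveCounters-decrAll s
PositiveCounters-decrAll ((z , suc zero) ∷ s)    = PositiveCounters-decrAll s
PositiveCounters-decrAll ((z , suc (suc c)) ∷ s) = s≤s z≤n ∷ PositiveCounters-decrAll s

WellFormed : Sketch → Set
WellFormed s = Unique (keys s) × PositiveCounters s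

slotMassNotIn : List Key → Key × ℕ → ℕ
slotMassNotIn T (z , c) = if does (z ∈? T) then 0 else c

massNotIn : List Key → Sketch → ℕ
massNotIn T []         = 0
massNotIn T (slot ∷ s) = slotMassNotIn T slot + massNotIn T s

massNotIn-incr : ∀ T x s → stored x s ≡ true → massNotIn T (incr x s) ≡ countNotIn T (x ∷ []) + massNotIn T s
massNotIn-incr T x ((z , c) ∷ s) st with x ≟ z
... | yes refl rewrite ≡ᵇ-refl x with x ∈? T
...   | yes _ = refl
...   | no  _ = refl
massNotIn-incr T x ((z , c) ∷ s) st | no x≢z rewrite ≢⇒≡ᵇ-false x≢z =
  trans (cong (_+_ (slotMassNotIn T (z , c))) (massNotIn-incr T x s st))
        (x∙yz≈y∙xz (slotMassNotIn T (z , c)) (countNotIn T (x ∷ [])) (massNotIn T s))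

massNotIn-append : ∀ T x s → massNotIn T (s ++ (x , 1) ∷ []) ≡ countNotIn T (x ∷ []) + massNotIn T s
massNotIn-append T x [] with x ∈? T
... | yes _ = refl
... | no  _ = refl
massNotIn-append T x ((z , c) ∷ s) =
  trans (cong (_+_ (slotMassNotIn T (z , c))) (massNotIn-append T x s))
        (x∙yz≈y∙xz (slotMassNotIn T (z , c)) (countNotIn T (x ∷ [])) (massNotIn T s))

massNotIn-decrAll : ∀ T s → PositiveCounters s → countNotIn T (keys s) + massNotIn T (decrAll s) ≡ massNotIn T s
massNotIn-decrAll T []                     []       = refl
massNotIn-decrAll T ((z , suc zero) ∷ s)    (_ ∷ ps) with z ∈? T
... | yes _ = massNotIn-decrAll T s ps
... | no  _ = cong suc (massNotIn-decrAll T s ps)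
massNotIn-decrAll T ((z , suc (suc c)) ∷ s) (_ ∷ ps) with z ∈? T
... | yes _ = massNotIn-decrAll T s ps
... | no  _ = cong suc (begin
  outside + suc (c + massNotIn T (decrAll s))   ≡⟨ +-suc outside _ ⟩
  suc (outside + (c + massNotIn T (decrAll s))) ≡⟨ cong suc (x∙yz≈y∙xz outside c (massNotIn T (decrAll s))) ⟩
  suc (c + (outside + massNotIn T (decrAll s))) ≡⟨ cong (λ m → suc (c + m)) (massNotIn-decrAll T s ps) ⟩
  suc (c + massNotIn T s)                       ∎)
  where
  open ≡-Reasoning
  outside = countNotIn T (keys s)

-- A single insertion

decrement : ℕ → Key → Sketch → ℕ
decrement w x s = if stored x s then 0 else if suc (length s) ≤ᵇ w then 0 else 1

data Insertion (w : ℕ) (x : Key) (s : Sketch) : Sketch → ℕ → Set where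
  hit      : stored x s ≡ true → Insertion w x s (incr x s) 0
  fresh    : stored x s ≡ false → length s < w → Insertion w x s (s ++ (x , 1) ∷ []) 0
  overflow : stored x s ≡ false → w ≤ length s → Insertion w x s (decrAll s) 1

insertion : ∀ w x s → Insertion w x s (mgInsert w x s) (decrement w x s)
insertion w x s with stored x s in st
... | true = hit st
... | false with suc (length s) ≤ᵇ w | ≤ᵇ-reflects-≤ (suc (length s)) w
...   | true  | ofʸ len<w = fresh st len<w
...   | false | ofⁿ len≮w = overflow st (≮⇒≥ len≮w)

estimate-insertion : ∀ {w x s s′ δ} → Insertion w x s s′ δ →
                     ∀ y → count y (x ∷ []) + estimate s y ≤ δ + estimate s′ y
estimate-insertion {x = x} {s} ins y with y ≟ x
estimate-insertion {x = x} {s} ins y | yes refl rewrite ≡ᵇ-refl y with ins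
... | hit st        = ≤-reflexive (sym (estimate-incr-self y s st))
... | fresh st _    rewrite estimate-not-stored y s st | estimate-append-self y s st = ≤-refl
... | overflow st _ rewrite estimate-not-stored y s st = s≤s z≤n
estimate-insertion {x = x} {s} ins y | no y≢x rewrite ≢⇒≡ᵇ-false y≢x with ins
... | hit _        = ≤-reflexive (sym (estimate-incr-other x s y≢x))
... | fresh _ _    = ≤-reflexive (sym (estimate-append-other x s y≢x))
... | overflow _ _ = estimate≤suc-estimate-decrAll s y

WellFormed-insertion : ∀ {w x s s′ δ} → Insertion w x s s′ δ → WellFormed s → WellFormed s′
WellFormed-insertion {x = x} {s} (hit _) (u , ps) =
  subst Unique (sym (keys-incr x s)) u , PositiveCounters-incr x s ps
WellFormed-insertion {x = x} {s} (fresh st _) (u , ps) =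
  subst Unique (sym (map-++ proj₁ s ((x , 1) ∷ [])))
    (Unique.++⁺ u ([] ∷ []) λ { (x∈s , here refl) → stored-false⇒∉ x s st x∈s ; (_ , there ()) }) ,
  All.++⁺ ps (s≤s z≤n ∷ [])
WellFormed-insertion {s = s} (overflow _ _) (u , ps) = Unique-keys-decrAll s u , PositiveCounters-decrAll s

massNotIn-insertion : ∀ T {k w x s s′ δ} → length T ≤ k → k ≤ w → WellFormed s → Insertion w x s s′ δ →
                      δ * suc (w ∸ k) + massNotIn T s′ ≤ countNotIn T (x ∷ []) + massNotIn T s
massNotIn-insertion T {x = x} {s} _ _ _ (hit st)    = ≤-reflexive (massNotIn-incr T x s st)
massNotIn-insertion T {x = x} {s} _ _ _ (fresh _ _) = ≤-reflexive (massNotIn-append T x s)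
massNotIn-insertion T {k} {w} {x} {s} T≤k k≤w (u , ps) (overflow st w≤len) = begin
  1 * suc (w ∸ k) + m                               ≡⟨ cong (_+ m) (*-identityˡ (suc (w ∸ k))) ⟩
  suc (w ∸ k) + m                                   ≤⟨ +-monoˡ-≤ m charge ⟩
  countNotIn T (x ∷ keys s) + m                     ≡⟨ cong (_+ m) (countNotIn-++ T (x ∷ []) (keys s)) ⟩
  countNotIn T (x ∷ []) + countNotIn T (keys s) + m ≡⟨ +-assoc (countNotIn T (x ∷ [])) (countNotIn T (keys s)) m ⟩
  countNotIn T (x ∷ []) + (countNotIn T (keys s) + m) ≡⟨ cong (_+_ (countNotIn T (x ∷ []))) (massNotIn-decrAll T s ps) ⟩
  countNotIn T (x ∷ []) + massNotIn T s             ∎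
  where
  open ≤-Reasoning
  m = massNotIn T (decrAll s)
  -- The w stored keys and x are distinct, and at most |T| of them lie in T.
  charge : suc (w ∸ k) ≤ countNotIn T (x ∷ keys s)
  charge = begin
    suc (w ∸ k)                    ≡⟨ +-∸-assoc 1 k≤w ⟨
    suc w ∸ k                      ≤⟨ ∸-mono (s≤s (≤-trans w≤len (≤-reflexive (sym (length-map proj₁ s))))) T≤k ⟩
    length (x ∷ keys s) ∸ length T ≤⟨ length∸length≤countNotIn T (All.¬Any⇒All¬ (keys s) (stored-false⇒∉ x s st) ∷ u) ⟩
    countNotIn T (x ∷ keys s)      ∎

-- Runs with a fixed number of slots

mgRun : ℕ → Sketch → List Key → Sketch
mgRun w s []       = s
mgRun w s (x ∷ xs) = mgRun w (mgInsert w x s) xs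

decrements : ℕ → Sketch → List Key → ℕ
decrements w s []       = 0
decrements w s (x ∷ xs) = decrement w x s + decrements w (mgInsert w x s) xs

estimate-mgRun : ∀ w s xs y → count y xs + estimate s y ≤ decrements w s xs + estimate (mgRun w s xs) y
estimate-mgRun w s []       y = ≤-refl
estimate-mgRun w s (x ∷ xs) y = begin
  count y (x ∷ xs) + estimate s y                ≡⟨ cong (_+ estimate s y) (count-++ y (x ∷ []) xs) ⟩
  count y (x ∷ []) + count y xs + estimate s y   ≡⟨ xy∙z≈y∙xz (count y (x ∷ [])) (count y xs) (estimate s y) ⟩
  count y xs + (count y (x ∷ []) + estimate s y) ≤⟨ +-monoʳ-≤ (count y xs) (estimate-insertion (insertion w x s) y) ⟩
  count y xs + (δ + estimate s′ y)               ≡⟨ x∙yz≈y∙xz (count y xs) δ (estimate s′ y) ⟩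
  δ + (count y xs + estimate s′ y)               ≤⟨ +-monoʳ-≤ δ (estimate-mgRun w s′ xs y) ⟩
  δ + (decrements w s′ xs + estimate (mgRun w s′ xs) y) ≡⟨ +-assoc δ _ _ ⟨
  δ + decrements w s′ xs + estimate (mgRun w s′ xs) y   ∎
  where
  open ≤-Reasoning
  s′ = mgInsert w x s
  δ  = decrement w x s

massNotIn-mgRun : ∀ T {k w} → length T ≤ k → k ≤ w → ∀ s xs → WellFormed s →
                  decrements w s xs * suc (w ∸ k) + massNotIn T (mgRun w s xs) ≤ countNotIn T xs + massNotIn T s
massNotIn-mgRun T T≤k k≤w s []       _  = ≤-refl
massNotIn-mgRun T {k} {w} T≤k k≤w s (x ∷ xs) wf = begin
  (δ + D) * a + m″                    ≡⟨ cong (_+ m″) (*-distribʳ-+ a δ D) ⟩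
  δ * a + D * a + m″                  ≡⟨ +-assoc (δ * a) (D * a) m″ ⟩
  δ * a + (D * a + m″)                ≤⟨ +-monoʳ-≤ (δ * a) (massNotIn-mgRun T T≤k k≤w s′ xs (WellFormed-insertion ins wf)) ⟩
  δ * a + (countNotIn T xs + m′)      ≡⟨ x∙yz≈y∙xz (δ * a) (countNotIn T xs) m′ ⟩
  countNotIn T xs + (δ * a + m′)      ≤⟨ +-monoʳ-≤ (countNotIn T xs) (massNotIn-insertion T T≤k k≤w wf ins) ⟩
  countNotIn T xs + (r + m)           ≡⟨ x∙yz≈y∙xz (countNotIn T xs) r m ⟩
  r + (countNotIn T xs + m)           ≡⟨ +-assoc r (countNotIn T xs) m ⟨
  r + countNotIn T xs + m             ≡⟨ cong (_+ m) (countNotIn-++ T (x ∷ []) xs) ⟨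
  countNotIn T (x ∷ xs) + m           ∎
  where
  open ≤-Reasoning
  ins = insertion w x s
  s′  = mgInsert w x s
  δ   = decrement w x s
  D   = decrements w s′ xs
  a   = suc (w ∸ k)
  r   = countNotIn T (x ∷ [])
  m   = massNotIn T s
  m′  = massNotIn T s′
  m″  = massNotIn T (mgRun w s′ xs)

-- Nonnegative fractions

toℚᵘ-/ : ∀ i e → toℚᵘ (i / suc e) ℚᵘ.≃ mkℚᵘ i e
toℚᵘ-/ i e = toℚᵘ-fromℚᵘ (mkℚᵘ i e)

/-≡-cross : ∀ i j e e′ → i ℤ.* + suc e′ ≡ j ℤ.* + suc e → i / suc e ≡ j / suc e′
/-≡-cross i j e e′ eq = fromℚᵘ-cong {mkℚᵘ i e} {mkℚᵘ j e′} (*≡* eq)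

/-≤-cross : ∀ i j e e′ → i ℤ.* + suc e′ ℤ.≤ j ℤ.* + suc e → i / suc e ℚ.≤ j / suc e′
/-≤-cross i j e e′ le = toℚᵘ-cancel-≤ (begin
  toℚᵘ (i / suc e)  ≃⟨ toℚᵘ-/ i e ⟩
  mkℚᵘ i e          ≤⟨ *≤* le ⟩
  mkℚᵘ j e′         ≃⟨ toℚᵘ-/ j e′ ⟨
  toℚᵘ (j / suc e′) ∎)
  where open ℚᵘ.≤-Reasoning

/-+ : ∀ m n e → + (m + n) / suc e ≡ + m / suc e ℚ.+ + n / suc e
/-+ m n e = toℚᵘ-injective (begin
  toℚᵘ (+ (m + n) / suc e)                   ≈⟨ toℚᵘ-/ (+ (m + n)) e ⟩
  mkℚᵘ (+ (m + n)) e                         ≈⟨ *≡* numerators ⟨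
  mkℚᵘ (+ m) e ℚᵘ.+ mkℚᵘ (+ n) e             ≈⟨ ℚᵘ.+-cong (toℚᵘ-/ (+ m) e) (toℚᵘ-/ (+ n) e) ⟨
  toℚᵘ (+ m / suc e) ℚᵘ.+ toℚᵘ (+ n / suc e) ≈⟨ toℚᵘ-homo-+ (+ m / suc e) (+ n / suc e) ⟨
  toℚᵘ (+ m / suc e ℚ.+ + n / suc e)         ∎)
  where
  open ℚᵘ.≃-Reasoning
  distrib : ∀ M N A → (M ℤ.* A ℤ.+ N ℤ.* A) ℤ.* A ≡ (M ℤ.+ N) ℤ.* (A ℤ.* A)
  distrib = solve-∀
  numerators : (+ m ℤ.* + suc e ℤ.+ + n ℤ.* + suc e) ℤ.* + suc e ≡ + (m + n) ℤ.* + (suc e * suc e)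
  numerators = trans (distrib (+ m) (+ n) (+ suc e)) (cong (+ (m + n) ℤ.*_) (sym (ℤ.pos-* (suc e) (suc e))))

/-cancel : ∀ d e → + (d * suc e) / suc e ≡ + d / 1
/-cancel d e = /-≡-cross (+ (d * suc e)) (+ d) e 0 (trans (ℤ.*-identityʳ _) (ℤ.pos-* d (suc e)))

/-split : ∀ d e m → + (d * suc e + m) / suc e ≡ + d / 1 ℚ.+ + m / suc e
/-split d e m = trans (/-+ (d * suc e) m e) (cong (ℚ._+ + m / suc e) (/-cancel d e))

/-monoˡ-≤ : ∀ {m n} e → m ≤ n → + m / suc e ℚ.≤ + n / suc e
/-monoˡ-≤ {m} {n} e m≤n = /-≤-cross (+ m) (+ n) e e (ℤ.*-monoʳ-≤-nonNeg (+ suc e) (+≤+ m≤n))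

/-antitoneʳ : ∀ m {e e′} → e ≤ e′ → + m / suc e′ ℚ.≤ + m / suc e
/-antitoneʳ m {e} {e′} e≤e′ = /-≤-cross (+ m) (+ m) e′ e (ℤ.*-monoˡ-≤-nonNeg (+ m) (+≤+ (s≤s e≤e′)))

/1-mono-≤ : ∀ {i j} → i ℤ.≤ j → i / 1 ℚ.≤ j / 1
/1-mono-≤ {i} {j} i≤j = /-≤-cross i j 0 0 (ℤ.*-monoʳ-≤-nonNeg (+ 1) i≤j)

0≤+/ : ∀ m e → 0ℚ ℚ.≤ + m / suc e
0≤+/ m e = subst (ℚ._≤ + m / suc e) (0/n≡0 (suc e)) (/-monoˡ-≤ {0} {m} e z≤n)

+[m+n]-+m≡+n : ∀ m n → + (m + n) - + m ≡ + n
+[m+n]-+m≡+n m n = begin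
  + (m + n) - + m ≡⟨ ℤ.[+m]-[+n]≡m⊖n (m + n) m ⟩
  (m + n) ℤ.⊖ m   ≡⟨ ℤ.⊖-≥ (m≤m+n m n) ⟩
  + (m + n ∸ m)   ≡⟨ cong +_ (m+n∸m≡n m n) ⟩
  + n             ∎
  where open ≡-Reasoning

+m-+o≤+n : ∀ {m} n o → m ≤ n + o → + m - + o ℤ.≤ + n
+m-+o≤+n {m} n o m≤n+o = begin
  + m - + o     ≡⟨ ℤ.[+m]-[+n]≡m⊖n m o ⟩
  m ℤ.⊖ o       ≤⟨ ℤ.⊖-monoˡ-≤ o m≤n+o ⟩
  (n + o) ℤ.⊖ o ≡⟨ ℤ.⊖-≥ (m≤n+m o n) ⟩
  + (n + o ∸ o) ≡⟨ cong +_ (m+n∸n≡m n o) ⟩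
  + n           ∎
  where open ℤ.≤-Reasoning

-- The potential argument

prev : (ℕ → ℕ) → ℕ → ℕ
prev f zero    = 0
prev f (suc j) = f j

natSumTo : (ℕ → ℕ) → ℕ → ℕ
natSumTo f zero    = f 0
natSumTo f (suc i) = natSumTo f i + f (suc i)

sumTo-cong : ∀ {f g : ℕ → ℚ} → (∀ j → f j ≡ g j) → ∀ i → sumTo f i ≡ sumTo g i
sumTo-cong f≗g zero    = f≗g 0
sumTo-cong f≗g (suc i) = cong₂ ℚ._+_ (sumTo-cong f≗g i) (f≗g (suc i))

potential-step : ∀ d m r m₀ {e e₀} → e₀ ≤ e → d * suc e + m ≤ r + m₀ →
                 + d / 1 ℚ.+ + m / suc e ℚ.≤ + m₀ / suc e₀ ℚ.+ + r / suc e
potential-step d m r m₀ {e} {e₀} e₀≤e budget = begin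
  + d / 1 ℚ.+ + m / suc e         ≡⟨ /-split d e m ⟨
  + (d * suc e + m) / suc e       ≤⟨ /-monoˡ-≤ e budget ⟩
  + (r + m₀) / suc e              ≡⟨ /-+ r m₀ e ⟩
  + r / suc e ℚ.+ + m₀ / suc e    ≤⟨ ℚ.+-monoʳ-≤ (+ r / suc e) (/-antitoneʳ m₀ e₀≤e) ⟩
  + r / suc e ℚ.+ + m₀ / suc e₀   ≡⟨ ℚ.+-comm (+ r / suc e) (+ m₀ / suc e₀) ⟩
  + m₀ / suc e₀ ℚ.+ + r / suc e   ∎
  where open ℚ.≤-Reasoning

potential-bound : ∀ (d m r e : ℕ → ℕ) → (∀ j → e j ≤ e (suc j)) → ∀ i →
                  (∀ j → j ≤ i → d j * suc (e j) + m j ≤ r j + prev m j) →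
                  + natSumTo d i / 1 ℚ.+ + m i / suc (e i) ℚ.≤ sumTo (λ j → + r j / suc (e j)) i
potential-bound d m r e e-mono zero budget = begin
  + d 0 / 1 ℚ.+ + m 0 / suc (e 0)    ≤⟨ potential-step (d 0) (m 0) (r 0) 0 ≤-refl (budget 0 z≤n) ⟩
  + 0 / suc (e 0) ℚ.+ + r 0 / suc (e 0) ≡⟨ /-+ 0 (r 0) (e 0) ⟨
  + r 0 / suc (e 0)                  ∎
  where open ℚ.≤-Reasoning
potential-bound d m r e e-mono (suc i) budget = begin
  + (D + d′) / 1 ℚ.+ + m′ / a′         ≡⟨ cong (ℚ._+ + m′ / a′) (/-+ D d′ 0) ⟩
  (+ D / 1 ℚ.+ + d′ / 1) ℚ.+ + m′ / a′ ≡⟨ ℚ.+-assoc (+ D / 1) (+ d′ / 1) (+ m′ / a′) ⟩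
  + D / 1 ℚ.+ (+ d′ / 1 ℚ.+ + m′ / a′)
    ≤⟨ ℚ.+-monoʳ-≤ (+ D / 1) (potential-step d′ m′ (r (suc i)) (m i) (e-mono i) (budget (suc i) ≤-refl)) ⟩
  + D / 1 ℚ.+ (+ m i / suc (e i) ℚ.+ + r (suc i) / a′)
    ≡⟨ ℚ.+-assoc (+ D / 1) (+ m i / suc (e i)) (+ r (suc i) / a′) ⟨
  (+ D / 1 ℚ.+ + m i / suc (e i)) ℚ.+ + r (suc i) / a′
    ≤⟨ ℚ.+-monoˡ-≤ (+ r (suc i) / a′) (potential-bound d m r e e-mono i (λ j j≤i → budget j (m≤n⇒m≤1+n j≤i))) ⟩
  sumTo (λ j → + r j / suc (e j)) i ℚ.+ + r (suc i) / a′ ∎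
  where
  open ℚ.≤-Reasoning
  D  = natSumTo d i
  d′ = d (suc i)
  m′ = m (suc i)
  a′ = suc (e (suc i))

-- Epochs

module Epochs (W Ns : ℕ → ℕ) (Ns-increasing : ∀ j → Ns j < Ns (suc j)) where

  Ns-mono-≤′ : ∀ {i j} → i ≤′ j → Ns i ≤ Ns j
  Ns-mono-≤′ ≤′-refl            = ≤-refl
  Ns-mono-≤′ (≤′-step {j} i≤′j) = ≤-trans (Ns-mono-≤′ i≤′j) (<⇒≤ (Ns-increasing j))

  Ns-mono-≤ : ∀ {i j} → i ≤ j → Ns i ≤ Ns j
  Ns-mono-≤ = Ns-mono-≤′ ∘ ≤⇒≤′

  Ns≤prev-Ns : ∀ {i j} → i < j → Ns i ≤ prev Ns j
  Ns≤prev-Ns {j = suc j} (s≤s i≤j) = Ns-mono-≤ i≤j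

  prev-Ns≤Ns : ∀ j → prev Ns j ≤ Ns j
  prev-Ns≤Ns zero    = z≤n
  prev-Ns≤Ns (suc j) = <⇒≤ (Ns-increasing j)

  n≤Ns : ∀ n → n ≤ Ns n
  n≤Ns zero    = z≤n
  n≤Ns (suc n) = ≤-trans (s≤s (n≤Ns n)) (Ns-increasing n)

  epochSearch-≡ : ∀ {t j} i fuel → i ≤ j → j ≤ i + fuel → prev Ns j < t → t ≤ Ns j →
                  epochSearch Ns t i fuel ≡ j
  epochSearch-≡ i zero i≤j j≤i+0 _ _ = ≤-antisym i≤j (subst (_ ≤_) (+-identityʳ i) j≤i+0)
  epochSearch-≡ {t} {j} i (suc fuel) i≤j j≤i+1+fuel prev<t t≤Nⱼ with t ≤ᵇ Ns i | ≤ᵇ-reflects-≤ t (Ns i)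
  ... | true  | ofʸ t≤Nᵢ = ≤-antisym i≤j (≮⇒≥ λ i<j → <⇒≱ prev<t (≤-trans t≤Nᵢ (Ns≤prev-Ns i<j)))
  ... | false | ofⁿ t≰Nᵢ = epochSearch-≡ (suc i) fuel (≤∧≢⇒< i≤j λ { refl → t≰Nᵢ t≤Nⱼ })
                             (subst (j ≤_) (+-suc i fuel) j≤i+1+fuel) prev<t t≤Nⱼ

  epochOf-≡ : ∀ {t j} → prev Ns j < t → t ≤ Ns j → epochOf Ns t ≡ j
  epochOf-≡ {t} {j} prev<t t≤Nⱼ = epochSearch-≡ 0 t z≤n (j≤t j prev<t) prev<t t≤Nⱼ
    where
    j≤t : ∀ j → prev Ns j < t → j ≤ t
    j≤t zero    _    = z≤n
    j≤t (suc j) Nⱼ<t = ≤-trans (s≤s (n≤Ns j)) Nⱼ<t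

  runFrom-++ : ∀ t s xs ys → runFrom W Ns t s (xs ++ ys) ≡ runFrom W Ns (t + length xs) (runFrom W Ns t s xs) ys
  runFrom-++ t s []       ys = cong (λ u → runFrom W Ns u s ys) (sym (+-identityʳ t))
  runFrom-++ t s (x ∷ xs) ys = trans (runFrom-++ (suc t) s′ xs ys)
                                     (cong (λ u → runFrom W Ns u (runFrom W Ns (suc t) s′ xs) ys) (sym (+-suc t (length xs))))
    where s′ = mgInsert (slotsAt W Ns t) x s

  runFrom-constant : ∀ {w} t s xs → (∀ u → t ≤ u → u < t + length xs → slotsAt W Ns u ≡ w) →
                     runFrom W Ns t s xs ≡ mgRun w s xs
  runFrom-constant t s []       _        = refl
  runFrom-constant {w} t s (x ∷ xs) constant =
    trans (cong (λ v → runFrom W Ns (suc t) (mgInsert v x s) xs) (constant t ≤-refl (m<m+n t (s≤s z≤n))))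
          (runFrom-constant (suc t) (mgInsert w x s) xs λ u t<u u<end →
             constant u (<⇒≤ t<u) (subst (u <_) (sym (+-suc t (length xs))) u<end))

  WellFormed-runFrom : ∀ t s xs → WellFormed s → WellFormed (runFrom W Ns t s xs)
  WellFormed-runFrom t s []       wf = wf
  WellFormed-runFrom t s (x ∷ xs) wf =
    WellFormed-runFrom (suc t) _ xs (WellFormed-insertion (insertion (slotsAt W Ns t) x s) wf)

  segment : List Key → ℕ → List Key
  segment str j = drop (prev Ns j) (take (Ns j) str)

  take-Ns≡take-prev-Ns++segment : ∀ str j → take (Ns j) str ≡ take (prev Ns j) str ++ segment str j
  take-Ns≡take-prev-Ns++segment str j = begin
    take (Ns j) str                                     ≡⟨ take++drop≡id (prev Ns j) (take (Ns j) str) ⟨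
    take (prev Ns j) (take (Ns j) str) ++ segment str j ≡⟨ cong (_++ segment str j) (take-take (prev Ns j) (Ns j) str) ⟩
    take (prev Ns j ⊓ Ns j) str ++ segment str j        ≡⟨ cong (λ n → take n str ++ segment str j) (m≤n⇒m⊓n≡m (prev-Ns≤Ns j)) ⟩
    take (prev Ns j) str ++ segment str j               ∎
    where open ≡-Reasoning

  sublimeMG-epoch : ∀ str j → Ns j ≤ length str →
                    sublimeMG W Ns str (Ns j) ≡ mgRun (W (Ns j)) (sublimeMG W Ns str (prev Ns j)) (segment str j)
  sublimeMG-epoch str j Nⱼ≤len = begin
    runFrom W Ns 1 [] (take (Ns j) str)                       ≡⟨ cong (runFrom W Ns 1 []) (take-Ns≡take-prev-Ns++segment str j) ⟩
    runFrom W Ns 1 [] (prefix ++ segment str j)               ≡⟨ runFrom-++ 1 [] prefix (segment str j) ⟩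
    runFrom W Ns (suc (length prefix)) before (segment str j) ≡⟨ cong (λ t → runFrom W Ns (suc t) before (segment str j)) length-prefix ⟩
    runFrom W Ns (suc (prev Ns j)) before (segment str j)     ≡⟨ runFrom-constant (suc (prev Ns j)) before (segment str j) in-epoch ⟩
    mgRun (W (Ns j)) before (segment str j)                   ∎
    where
    open ≡-Reasoning
    prefix = take (prev Ns j) str
    before = sublimeMG W Ns str (prev Ns j)
    length-prefix : length prefix ≡ prev Ns j
    length-prefix = trans (length-take (prev Ns j) str) (m≤n⇒m⊓n≡m (≤-trans (prev-Ns≤Ns j) Nⱼ≤len))
    length-segment : length (segment str j) ≡ Ns j ∸ prev Ns j
    length-segment = trans (length-drop (prev Ns j) (take (Ns j) str))
                           (cong (_∸ prev Ns j) (trans (length-take (Ns j) str) (m≤n⇒m⊓n≡m Nⱼ≤len)))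
    end≡ : suc (prev Ns j) + length (segment str j) ≡ suc (Ns j)
    end≡ = cong suc (trans (cong (_+_ (prev Ns j)) length-segment) (m+[n∸m]≡n (prev-Ns≤Ns j)))
    in-epoch : ∀ u → suc (prev Ns j) ≤ u → u < suc (prev Ns j) + length (segment str j) → slotsAt W Ns u ≡ W (Ns j)
    in-epoch u prev<u u<end = cong (W ∘ Ns) (epochOf-≡ prev<u (s≤s⁻¹ (≤-trans u<end (≤-reflexive end≡))))

module Analysis (W Ns : ℕ → ℕ) (Ns-increasing : ∀ j → Ns j < Ns (suc j))
                (W-increasing : ∀ j → W (Ns j) < W (Ns (suc j)))
                (k : ℕ) (k≤W₀ : k ≤ W (Ns 0)) (T : List Key) (T≤k : length T ≤ k) (str : List Key) where

  open Epochs W Ns Ns-increasing public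

  sketchBefore sketchAfter : ℕ → Sketch
  sketchBefore j = sublimeMG W Ns str (prev Ns j)
  sketchAfter  j = sublimeMG W Ns str (Ns j)

  excess decrementsIn massAfter residualIn : ℕ → ℕ
  excess       j = W (Ns j) ∸ k
  decrementsIn j = decrements (W (Ns j)) (sketchBefore j) (segment str j)
  massAfter    j = massNotIn T (sketchAfter j)
  residualIn   j = countNotIn T (segment str j)

  k≤W : ∀ j → k ≤ W (Ns j)
  k≤W zero    = k≤W₀
  k≤W (suc j) = ≤-trans (k≤W j) (<⇒≤ (W-increasing j))

  excess-mono : ∀ j → excess j ≤ excess (suc j)
  excess-mono j = ∸-monoˡ-≤ k (<⇒≤ (W-increasing j))

  count-epoch : ∀ j → Ns j ≤ length str → ∀ y P → count y (take (prev Ns j) str) ≤ P + estimate (sketchBefore j) y →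
                count y (take (Ns j) str) ≤ P + decrementsIn j + estimate (sketchAfter j) y
  count-epoch j Nⱼ≤len y P before-bound = begin
    count y (take (Ns j) str)                              ≡⟨ cong (count y) (take-Ns≡take-prev-Ns++segment str j) ⟩
    count y (take (prev Ns j) str ++ segment str j)        ≡⟨ count-++ y (take (prev Ns j) str) (segment str j) ⟩
    count y (take (prev Ns j) str) + count y (segment str j) ≤⟨ +-monoˡ-≤ (count y (segment str j)) before-bound ⟩
    P + estimate before y + count y (segment str j)        ≡⟨ xy∙z≈x∙zy P (estimate before y) (count y (segment str j)) ⟩
    P + (count y (segment str j) + estimate before y)      ≤⟨ +-monoʳ-≤ P (estimate-mgRun (W (Ns j)) before (segment str j) y) ⟩
    P + (decrementsIn j + estimate (mgRun (W (Ns j)) before (segment str j)) y)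
      ≡⟨ cong (λ s → P + (decrementsIn j + estimate s y)) (sublimeMG-epoch str j Nⱼ≤len) ⟨
    P + (decrementsIn j + estimate (sketchAfter j) y)      ≡⟨ +-assoc P (decrementsIn j) (estimate (sketchAfter j) y) ⟨
    P + decrementsIn j + estimate (sketchAfter j) y        ∎
    where
    open ≤-Reasoning
    before = sketchBefore j

  count≤decrements+estimate : ∀ i → Ns i ≤ length str → ∀ y →
                              count y (take (Ns i) str) ≤ natSumTo decrementsIn i + estimate (sketchAfter i) y
  count≤decrements+estimate zero    N₀≤len y = count-epoch 0 N₀≤len y 0 z≤n
  count≤decrements+estimate (suc i) Nᵢ≤len y = count-epoch (suc i) Nᵢ≤len y (natSumTo decrementsIn i)
    (count≤decrements+estimate i (≤-trans (<⇒≤ (Ns-increasing i)) Nᵢ≤len) y)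

  massBefore≡prev-massAfter : ∀ j → massNotIn T (sketchBefore j) ≡ prev massAfter j
  massBefore≡prev-massAfter zero    = refl
  massBefore≡prev-massAfter (suc j) = refl

  epoch-budget : ∀ j → Ns j ≤ length str →
                 decrementsIn j * suc (excess j) + massAfter j ≤ residualIn j + prev massAfter j
  epoch-budget j Nⱼ≤len =
    subst₂ (λ s m → decrementsIn j * suc (excess j) + massNotIn T s ≤ residualIn j + m)
      (sym (sublimeMG-epoch str j Nⱼ≤len)) (massBefore≡prev-massAfter j)
      (massNotIn-mgRun T T≤k (k≤W j) (sketchBefore j) (segment str j)
        (WellFormed-runFrom 1 [] (take (prev Ns j) str) ([] , [])))

  residualPrev≡countNotIn : ∀ j → residualPrev T str Ns j ≡ countNotIn T (take (prev Ns j) str)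
  residualPrev≡countNotIn zero    = refl
  residualPrev≡countNotIn (suc j) = refl

  boundTerm≡ : ∀ j → boundTerm W Ns k T str j ≡ + residualIn j / suc (excess j)
  boundTerm≡ j = cong (_/ suc (excess j)) (begin
    + residual T str (Ns j) - + residualPrev T str Ns j
      ≡⟨ cong₂ (λ a b → + a - + b) residual≡ (residualPrev≡countNotIn j) ⟩
    + (countNotIn T prefix + residualIn j) - + countNotIn T prefix
      ≡⟨ +[m+n]-+m≡+n (countNotIn T prefix) (residualIn j) ⟩
    + residualIn j ∎)
    where
    open ≡-Reasoning
    prefix = take (prev Ns j) str
    residual≡ : residual T str (Ns j) ≡ countNotIn T prefix + residualIn j
    residual≡ = trans (cong (countNotIn T) (take-Ns≡take-prev-Ns++segment str j)) (countNotIn-++ T prefix (segment str j))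

lemmaB5 : (W : ℕ → ℕ) → (∀ m n → m ≤ n → W m ≤ W n)
          → (Ns : ℕ → ℕ) → (∀ j → Ns j < Ns (suc j)) → (∀ j → W (Ns j) < W (Ns (suc j)))
          → (k : ℕ) → 1 ≤ k → k ≤ W (Ns 0)
          → (str : List Key) → (T : List Key) → IsTopK k str T
          → (i : ℕ) → Ns i ≤ length str
          → ∀ x → (toℚ (+ count x (take (Ns i) str) - + estimate (sublimeMG W Ns str (Ns i)) x))
                  ℚ.≤ sumTo (boundTerm W Ns k T str) i
lemmaB5 W _ Ns Ns-increasing W-increasing k _ k≤W₀ str T (_ , T-length , _) i Nᵢ≤len x = begin
  toℚ (+ count x (take (Ns i) str) - + estimate (sketchAfter i) x)
    ≤⟨ /1-mono-≤ (+m-+o≤+n D (estimate (sketchAfter i) x) (count≤decrements+estimate i Nᵢ≤len x)) ⟩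
  + D / 1                                         ≡⟨ ℚ.+-identityʳ (+ D / 1) ⟨
  + D / 1 ℚ.+ 0ℚ                                  ≤⟨ ℚ.+-monoʳ-≤ (+ D / 1) (0≤+/ (massAfter i) (excess i)) ⟩
  + D / 1 ℚ.+ + massAfter i / suc (excess i)
    ≤⟨ potential-bound decrementsIn massAfter residualIn excess excess-mono i
         (λ j j≤i → epoch-budget j (≤-trans (Ns-mono-≤ j≤i) Nᵢ≤len)) ⟩
  sumTo (λ j → + residualIn j / suc (excess j)) i ≡⟨ sumTo-cong boundTerm≡ i ⟨
  sumTo (boundTerm W Ns k T str) i                ∎
  where
  open Analysis W Ns Ns-increasing W-increasing k k≤W₀ T (≤-reflexive T-length) str
  open ℚ.≤-Reasoning
  D = natSumTo decrementsIn i
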